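{- Let $\mathbb{F}$ be a finite field and $d\ge0$. For $\alpha<\frac{\varepsilon}{d+2+\varepsilon}$, one can $\alpha$-erasure-resilient $\varepsilon$-test the property of functions $f:\mathbb{F}\to\mathbb{F}$ of being a polynomial of degree at most $d$ using $O\!\left(\frac{d+2}{\varepsilon(1-\alpha)-\alpha(d+2)}\right)$ uniform queries.
   Context: An $\alpha$-erased function $f:\mathcal{D}\to\mathcal{R}\cup\{\perp\}$ takes the value $\perp$ (erased) on at most an $\alpha$ fraction of $\mathcal{D}$; $\mathcal{N}$ denotes the nonerased points; a restoration is a function $\mathcal{D}\to\mathcal{R}$ agreeing with $f$ on $\mathcal{N}$. An $\alpha$-erasure-resilient $\varepsilon$-tester for $\mathcal{P}$ gets query access to an $\alpha$-erased $f$ (queries return $f(x)$ or $\perp$, $\mathcal{N}$ unknown in advance) and, with probability at least $2/3$, accepts if some restoration lies in $\mathcal{P}$ and rejects if every restoration must be changed on at least an $\varepsilon$ fraction of $\mathcal{N}$ to lie in $\mathcal{P}$. Uniform queries means the queried points are sampled uniformly and independently from the domain.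
   Formalization: The parameters α and ε range only over the rationals. -}

module Defs where

open import Level using (0ℓ)
open import Data.Nat using (ℕ; zero; suc; _^_)
import Data.Nat as ℕ
open import Data.Integer using (+_)
open import Data.Rational using (ℚ; _/_)
import Data.Rational as ℚ
open import Data.Fin using (Fin)
open import Data.Vec using (Vec; []; _∷_; foldr)
open import Data.Bool using (Bool; true; false) renaming (_≟_ to _≟ᵇ_)
open import Data.Maybe using (Maybe; just; nothing)
open import Data.Product using (Σ; ∃; _×_; _,_)
open import Data.List using (List; allFin; filter; length; map)
open import Data.Nat.ListAction using (sum)
import Data.Vec
open import Relation.Nullary using (¬_; Dec; yes; no)
open import Relation.Unary using (Pred; Decidable)
open import Relation.Binary.PropositionalEquality using (_≡_; _≢_)
open import Function.Bundles using (_↔_; Inverse)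
open import Algebra.Bundles using (CommutativeRing)

ℕ→ℚ : ℕ → ℚ
ℕ→ℚ n = + n / 1

record FiniteField : Set₁ where
  field
    ring : CommutativeRing 0ℓ 0ℓ
  open CommutativeRing ring public hiding (ring)
  field
    ≈⇒≡      : ∀ {x y} → x ≈ y → x ≡ y
    0≉1      : ¬ (0# ≈ 1#)
    inverse  : ∀ x → ¬ (x ≈ 0#) → ∃ λ y → (x * y) ≈ 1#
    size     : ℕ
    enum     : Fin size ↔ Carrier
    _≟F_     : (x y : Carrier) → Dec (x ≡ y)

module _ (F : FiniteField) where
  open FiniteField F

  elem : Fin size → Carrier
  elem = Inverse.to enum

  countF : {P : Pred Carrier 0ℓ} → Decidable P → ℕ
  countF P? = length (filter (λ i → P? (elem i)) (allFin size))

  evalPoly : ∀ {n} → Vec Carrier n → Carrier → Carrier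
  evalPoly cs x = foldr _ (λ c acc → c + x * acc) 0# cs

  IsPolyDeg≤ : ℕ → (Carrier → Carrier) → Set
  IsPolyDeg≤ d g = Σ (Vec Carrier (suc d)) λ cs → ∀ x → g x ≡ evalPoly cs x

  -- erased functions: nothing plays the role of ⊥
  ErasedFun : Set
  ErasedFun = Carrier → Maybe Carrier

  isErased : (f : ErasedFun) → Decidable (λ x → f x ≡ nothing)
  isErased f x with f x
  ... | nothing = yes _≡_.refl
  ... | just _  = no (λ ())

  isNonErased : (f : ErasedFun) → Decidable (λ x → f x ≢ nothing)
  isNonErased f x with f x
  ... | nothing = no (λ h → h _≡_.refl)
  ... | just _  = yes (λ ())

  numNonErased : ErasedFun → ℕ
  numNonErased f = countF (isNonErased f)

  IsErased : ℚ → ErasedFun → Set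
  IsErased α f = ℕ→ℚ (countF (isErased f)) ℚ.≤ α ℚ.* ℕ→ℚ size

  Restoration : ErasedFun → (Carrier → Carrier) → Set
  Restoration f h = ∀ x y → f x ≡ just y → h x ≡ y

  disagree : (f : ErasedFun) (h g : Carrier → Carrier) →
             Decidable (λ x → f x ≢ nothing × h x ≢ g x)
  disagree f h g x with isNonErased f x | h x ≟F g x
  ... | yes p | yes q = no (λ { (_ , r) → r q })
  ... | yes p | no q  = yes (p , q)
  ... | no p  | _     = no (λ { (r , _) → p r })

  RestorableToPoly : ℕ → ErasedFun → Set
  RestorableToPoly d f = Σ (Carrier → Carrier) λ h → Restoration f h × IsPolyDeg≤ d h

  FarFromPoly : ℕ → ℚ → ErasedFun → Set
  FarFromPoly d ε f = ∀ h → Restoration f h → ∀ g → IsPolyDeg≤ d g →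
    ε ℚ.* ℕ→ℚ (numNonErased f) ℚ.≤ ℕ→ℚ (countF (disagree f h g))

  -- A tester making m uniform queries: it receives m independent uniform
  -- points together with the oracle answers, plus an internal random seed
  -- uniform in Fin (suc r), and outputs accept (true) / reject (false).
  record UniformTester : Set where
    field
      queries : ℕ
      coins   : ℕ
      decide  : Vec (Carrier × Maybe Carrier) queries → Fin (suc coins) → Bool

  sumVecs : (m : ℕ) → (Vec (Fin size) m → ℕ) → ℕ
  sumVecs zero    g = g []
  sumVecs (suc m) g = sum (map (λ i → sumVecs m (λ v → g (i ∷ v))) (allFin size))

  countSeeds : (k : ℕ) → (Fin k → Bool) → ℕ
  countSeeds k P = length (filter (λ i → P i ≟ᵇ true) (allFin k))

  -- number of outcomes (samples, seed) on which T accepts f; the total number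
  -- of equally likely outcomes is size ^ queries * suc coins
  acceptCount : UniformTester → ErasedFun → ℕ
  acceptCount T f = sumVecs queries λ v →
      countSeeds (suc coins) (decide (Data.Vec.map (λ i → elem i , f (elem i)) v))
    where open UniformTester T

  totalOutcomes : UniformTester → ℕ
  totalOutcomes T = size ^ queries ℕ.* suc coins
    where open UniformTester T

  AcceptsWHP : UniformTester → ErasedFun → Set
  AcceptsWHP T f = 2 ℕ.* totalOutcomes T ℕ.≤ 3 ℕ.* acceptCount T f

  RejectsWHP : UniformTester → ErasedFun → Set
  RejectsWHP T f = 3 ℕ.* acceptCount T f ℕ.≤ totalOutcomes T

  IsErasureResilientTester : ℕ → ℚ → ℚ → UniformTester → Set
  IsErasureResilientTester d α ε T = ∀ (f : ErasedFun) → IsErased α f →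
    (RestorableToPoly d f → AcceptsWHP T f) × (FarFromPoly d ε f → RejectsWHP T f)

module Submission where

-- The tester samples m = (L + 1)(d + 4) uniform points and accepts iff some polynomial of degree ≤ d fits
-- all nonerased samples, so it never rejects a restorable f. L is chosen with 2 ≤ (L + 1) ε (1 − α) ≤ 3,
-- which gives the query bound with C = 6. If f is far, at most α|F| points are erased, so every polynomial
-- disagrees with f on at least ε (1 − α) |F| nonerased points, hence on at least a points where
-- (L + 1) a ≥ 2|F|.
-- Soundness is a potential argument. Given distinct nonerased sampled points ("anchors") and a budget r
-- with r + #anchors > d, at most 2^(r+1) (|F| − a/2)^m of the |F|^m continuations of length m remain
-- consistent: a sample at one of the ≥ a points where f disagrees with the current fit is either a new
-- anchor, using up budget, or, once d + 1 anchors pin the fit down, inconsistent with every polynomial.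
-- Bernoulli's inequality gives (1 − a/(2|F|))^(L+1) ≤ 1/2, so starting from budget d + 1 the acceptance
-- probability is at most 2^(d+2) · 2^−(d+4) = 1/4.

open import Defs
open import Level using (0ℓ)
open import Data.Nat using (ℕ; zero; suc)
open import Data.Product using (Σ; _×_; _,_; map₁)
open import Data.Sum using (_⊎_; inj₁; inj₂)
open import Data.Empty using (⊥-elim)
open import Data.List using (List; []; _∷_; map; filter; length; allFin)
open import Data.Nat.ListAction using (sum)
open import Relation.Nullary using (¬_; Dec; yes; no)
open import Relation.Unary using (Pred; Decidable)
open import Relation.Binary.PropositionalEquality as ≡ using (_≡_; _≢_; cong; cong₂)
open import Data.List.Properties using (length-tabulate)

length-allFin : ∀ n → length (allFin n) ≡ n
length-allFin n = length-tabulate {n = n} (λ i → i)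

module ListCounting {A : Set} where
  open import Data.Nat
  open import Data.Nat.Properties
  open import Data.Nat.Tactic.RingSolver using (solve-∀)
  open ≡ using (refl; sym; trans)

  sum-map-const : ∀ k (xs : List A) → sum (map (λ _ → k) xs) ≡ length xs * k
  sum-map-const k []       = refl
  sum-map-const k (x ∷ xs) = cong (k +_) (sum-map-const k xs)

  sum-map-*ˡ : ∀ c (f : A → ℕ) xs → sum (map (λ x → c * f x) xs) ≡ c * sum (map f xs)
  sum-map-*ˡ c f []       = sym (*-zeroʳ c)
  sum-map-*ˡ c f (x ∷ xs) = trans (cong (c * f x +_) (sum-map-*ˡ c f xs)) (sym (*-distribˡ-+ c (f x) _))

  length-filter-complement : ∀ {P Q : Pred A 0ℓ} (P? : Decidable P) (Q? : Decidable Q) →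
    (∀ {x} → P x → ¬ Q x) → (∀ {x} → ¬ P x → Q x) → ∀ xs →
    length (filter P? xs) + length (filter Q? xs) ≡ length xs
  length-filter-complement P? Q? P⇒¬Q ¬P⇒Q [] = refl
  length-filter-complement P? Q? P⇒¬Q ¬P⇒Q (x ∷ xs) with P? x | Q? x
  ... | yes p | yes q = ⊥-elim (P⇒¬Q p q)
  ... | yes _ | no  _ = cong suc (length-filter-complement P? Q? P⇒¬Q ¬P⇒Q xs)
  ... | no  _ | yes _ = trans (+-suc _ _) (cong suc (length-filter-complement P? Q? P⇒¬Q ¬P⇒Q xs))
  ... | no ¬p | no ¬q = ⊥-elim (¬q (¬P⇒Q ¬p))

  sum-map-filter-≤ : ∀ {P : Pred A 0ℓ} (P? : Decidable P) (f : A → ℕ) {v w} →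
    (∀ {x} → P x → f x + w ≤ v) → (∀ {x} → ¬ P x → f x ≤ v) → ∀ xs →
    sum (map f xs) + length (filter P? xs) * w ≤ length xs * v
  sum-map-filter-≤ P? f P⇒ ¬P⇒ [] = z≤n
  sum-map-filter-≤ P? f {v} {w} P⇒ ¬P⇒ (x ∷ xs) with P? x
  ... | yes p = begin
    (f x + S) + (w + n * w)  ≡⟨ interchange (f x) S w (n * w) ⟩
    (f x + w) + (S + n * w)  ≤⟨ +-mono-≤ (P⇒ p) (sum-map-filter-≤ P? f P⇒ ¬P⇒ xs) ⟩
    v + length xs * v        ∎
    where
      open ≤-Reasoning
      S = sum (map f xs)
      n = length (filter P? xs)
      interchange : ∀ a b c e → (a + b) + (c + e) ≡ (a + c) + (b + e)
      interchange = solve-∀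
  ... | no ¬p = begin
    (f x + S) + n * w  ≡⟨ +-assoc (f x) S _ ⟩
    f x + (S + n * w)  ≤⟨ +-mono-≤ (¬P⇒ ¬p) (sum-map-filter-≤ P? f P⇒ ¬P⇒ xs) ⟩
    v + length xs * v  ∎
    where
      open ≤-Reasoning
      S = sum (map f xs)
      n = length (filter P? xs)

module NatArithmetic where
  open import Data.Nat
  open import Data.Nat.Properties
  open import Data.Nat.Tactic.RingSolver using (solve-∀)
  open ≡ using (refl; sym; trans)

  ^-distribʳ-* : ∀ m n o → (m * n) ^ o ≡ m ^ o * n ^ o
  ^-distribʳ-* m n zero    = refl
  ^-distribʳ-* m n (suc o) = trans (cong ((m * n) *_) (^-distribʳ-* m n o)) (shuffle m n (m ^ o) (n ^ o))
    where
      shuffle : ∀ a b c e → (a * b) * (c * e) ≡ (a * c) * (b * e)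
      shuffle = solve-∀

  -- Bernoulli's inequality (1 + a/X)^L ≥ 1 + L a / X, cleared of denominators.
  bernoulli : ∀ L X a → X ^ L * (X + L * a) ≤ (X + a) ^ L * X
  bernoulli zero    X a = ≤-reflexive (cong (1 *_) (+-identityʳ X))
  bernoulli (suc L) X a = begin
    X * X ^ L * (X + suc L * a)                               ≤⟨ m≤m+n _ (X ^ L * L * a * a) ⟩
    X * X ^ L * (X + suc L * a) + X ^ L * L * a * a           ≡⟨ expand X (X ^ L) L a ⟩
    (X + a) * (X ^ L * (X + L * a))                           ≤⟨ *-monoʳ-≤ (X + a) (bernoulli L X a) ⟩
    (X + a) * ((X + a) ^ L * X)                               ≡⟨ *-assoc (X + a) _ X ⟨
    (X + a) ^ suc L * X                                       ∎
    where
      open ≤-Reasoning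
      expand : ∀ X P L a → X * P * (X + (1 + L) * a) + P * L * a * a ≡ (X + a) * (P * (X + L * a))
      expand = solve-∀

  doubling : ∀ L X a → X ≤ suc L * a → 2 * X ^ suc L ≤ (X + a) ^ suc L
  doubling L zero      a X≤La = z≤n
  doubling L X@(suc _) a X≤La = *-cancelʳ-≤ _ _ X (begin
    2 * X ^ suc L * X              ≡⟨ twice (X ^ suc L) X ⟩
    X ^ suc L * (X + X)            ≤⟨ *-monoʳ-≤ (X ^ suc L) (+-monoʳ-≤ X X≤La) ⟩
    X ^ suc L * (X + suc L * a)    ≤⟨ bernoulli (suc L) X a ⟩
    (X + a) ^ suc L * X            ∎)
    where
      open ≤-Reasoning
      twice : ∀ P X → 2 * P * X ≡ P * (X + X)
      twice = solve-∀

  doubling-^ : ∀ L j X a → X ≤ suc L * a → 2 ^ j * X ^ (suc L * j) ≤ (X + a) ^ (suc L * j)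
  doubling-^ L j X a X≤La = begin
    2 ^ j * X ^ (suc L * j)        ≡⟨ cong (2 ^ j *_) (^-*-assoc X (suc L) j) ⟨
    2 ^ j * (X ^ suc L) ^ j        ≡⟨ ^-distribʳ-* 2 (X ^ suc L) j ⟨
    (2 * X ^ suc L) ^ j            ≤⟨ ^-monoˡ-≤ j (doubling L X a X≤La) ⟩
    ((X + a) ^ suc L) ^ j          ≡⟨ ^-*-assoc (X + a) (suc L) j ⟩
    (X + a) ^ (suc L * j)          ∎
    where open ≤-Reasoning

  Least : Pred ℕ 0ℓ → Set
  Least P = Σ ℕ λ n → P n × (∀ {m} → P m → n ≤ m)

  least-or-none≤ : ∀ {P} → Decidable P → ∀ w → Least P ⊎ (∀ {m} → m ≤ w → ¬ P m)
  least-or-none≤ P? zero with P? zero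
  ... | yes P0 = inj₁ (zero , P0 , λ _ → z≤n)
  ... | no ¬P0 = inj₂ λ { z≤n → ¬P0 }
  least-or-none≤ {P} P? (suc w) with least-or-none≤ P? w | P? (suc w)
  ... | inj₁ least     | _       = inj₁ least
  ... | inj₂ noneBelow | yes Psw =
    inj₁ (suc w , Psw , λ Pm → ≮⇒≥ λ m<sw → noneBelow (≤-pred m<sw) Pm)
  ... | inj₂ noneBelow | no ¬Psw = inj₂ λ m≤sw → noneUpTo (m≤n⇒m<n∨m≡n m≤sw)
    where
      noneUpTo : ∀ {m} → m < suc w ⊎ m ≡ suc w → ¬ P m
      noneUpTo (inj₁ m<sw) = noneBelow (≤-pred m<sw)
      noneUpTo (inj₂ refl) = ¬Psw

  least : ∀ {P} → Decidable P → ∀ {w} → P w → Least P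
  least P? {w} Pw with least-or-none≤ P? w
  ... | inj₁ least′    = least′
  ... | inj₂ noneBelow = ⊥-elim (noneBelow ≤-refl Pw)

module Polynomial (F : FiniteField) where
  open FiniteField F
  open import Data.Nat using (_≤_; s≤s)
  open import Data.Vec using (Vec; []; _∷_)
  open import Data.List.Relation.Unary.All using (All; []; _∷_)
  open import Data.List.Relation.Unary.AllPairs using (AllPairs; []; _∷_)
  open import Algebra.Properties.Group +-group using (∙-cancelˡ; \\-leftDividesˡ)
  open import Algebra.Solver.Ring.NaturalCoefficients.Default commutativeSemiring
  import Relation.Binary.Reasoning.Setoid setoid as ≈-Reasoning

  private
    eval : ∀ {n} → Vec Carrier n → Carrier → Carrier
    eval = evalPoly F

  -- Synthetic division by X − a (Horner's scheme).
  quotient : ∀ {n} → Vec Carrier (suc n) → Carrier → Vec Carrier n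
  quotient (c ∷ [])      a = []
  quotient (c ∷ c′ ∷ cs) a = eval (c′ ∷ cs) a ∷ quotient (c′ ∷ cs) a

  evalPoly-shift : ∀ {n} (cs : Vec Carrier (suc n)) a w →
    eval cs (a + w) ≡ eval cs a + w * eval (quotient cs a) (a + w)
  evalPoly-shift (c ∷ [])      a w =
    ≈⇒≡ (solve 3 (λ c a w → c :+ (a :+ w) :* con 0 := (c :+ a :* con 0) :+ w :* con 0) refl c a w)
  evalPoly-shift (c ∷ c′ ∷ cs) a w =
    ≡.trans (cong (λ t → c + (a + w) * t) (evalPoly-shift (c′ ∷ cs) a w))
            (≈⇒≡ (solve 5 (λ c a w e q → c :+ (a :+ w) :* (e :+ w :* q)
                                      := (c :+ a :* e) :+ w :* (e :+ (a :+ w) :* q))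
                          refl c a w (eval (c′ ∷ cs) a) (eval (quotient (c′ ∷ cs) a) (a + w))))

  evalPoly-factor : ∀ {n} (cs : Vec Carrier (suc n)) a z →
    eval cs z ≡ eval cs a + (- a + z) * eval (quotient cs a) z
  evalPoly-factor cs a z =
    ≡.subst (λ t → eval cs t ≡ eval cs a + (- a + z) * eval (quotient cs a) t)
            (≈⇒≡ (\\-leftDividesˡ a z)) (evalPoly-shift cs a (- a + z))

  -a+x≉0 : ∀ {x a} → x ≢ a → ¬ (- a + x ≈ 0#)
  -a+x≉0 {x} {a} x≢a -a+x≈0 =
    x≢a (≈⇒≡ (∙-cancelˡ (- a) x a (trans -a+x≈0 (sym (-‿inverseˡ a)))))

  *-cancelˡ-≉0 : ∀ {w u v} → ¬ (w ≈ 0#) → w * u ≡ w * v → u ≡ v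
  *-cancelˡ-≉0 {w} {u} {v} w≉0 wu≡wv with inverse w w≉0
  ... | w⁻¹ , ww⁻¹≈1 = ≈⇒≡ (begin
    u                ≈⟨ *-identityˡ u ⟨
    1# * u           ≈⟨ *-congʳ w⁻¹w≈1 ⟨
    (w⁻¹ * w) * u    ≈⟨ *-assoc w⁻¹ w u ⟩
    w⁻¹ * (w * u)    ≡⟨ cong (w⁻¹ *_) wu≡wv ⟩
    w⁻¹ * (w * v)    ≈⟨ *-assoc w⁻¹ w v ⟨
    (w⁻¹ * w) * v    ≈⟨ *-congʳ w⁻¹w≈1 ⟩
    1# * v           ≈⟨ *-identityˡ v ⟩
    v                ∎)
    where
      open ≈-Reasoning
      w⁻¹w≈1 : w⁻¹ * w ≈ 1#
      w⁻¹w≈1 = trans (*-comm w⁻¹ w) ww⁻¹≈1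

  quotient-agree : ∀ {n} (g h : Vec Carrier (suc n)) {a x} → x ≢ a →
    eval g a ≡ eval h a → eval g x ≡ eval h x →
    eval (quotient g a) x ≡ eval (quotient h a) x
  quotient-agree g h {a} {x} x≢a ga≡ha gx≡hx = *-cancelˡ-≉0 (-a+x≉0 x≢a)
    (≈⇒≡ (∙-cancelˡ (eval g a) _ _ (begin
      eval g a + (- a + x) * eval (quotient g a) x  ≡⟨ evalPoly-factor g a x ⟨
      eval g x                                      ≡⟨ gx≡hx ⟩
      eval h x                                      ≡⟨ evalPoly-factor h a x ⟩
      eval h a + (- a + x) * eval (quotient h a) x  ≡⟨ cong (_+ _) ga≡ha ⟨
      eval g a + (- a + x) * eval (quotient h a) x  ∎)))
    where open ≈-Reasoning

  evalPoly-unique : ∀ {n} (g h : Vec Carrier n) (xs : List Carrier) → AllPairs _≢_ xs → n ≤ length xs →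
    All (λ x → eval g x ≡ eval h x) xs → ∀ z → eval g z ≡ eval h z
  evalPoly-unique []      []      _        _              _        _             z = ≡.refl
  evalPoly-unique g@(_ ∷ _) h@(_ ∷ _) (a ∷ xs) (a≢xs ∷ distinct) (s≤s n≤) (ga≡ha ∷ agree) z = begin
    eval g z                                      ≡⟨ evalPoly-factor g a z ⟩
    eval g a + (- a + z) * eval (quotient g a) z  ≡⟨ cong₂ (λ s t → s + (- a + z) * t) ga≡ha
                                                      (evalPoly-unique (quotient g a) (quotient h a) xs distinct n≤
                                                        (quotientsAgree a≢xs agree) z) ⟩
    eval h a + (- a + z) * eval (quotient h a) z  ≡⟨ evalPoly-factor h a z ⟨
    eval h z                                      ∎
    where
      open ≡.≡-Reasoning
      quotientsAgree : ∀ {ys} → All (a ≢_) ys → All (λ x → eval g x ≡ eval h x) ys →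
                       All (λ x → eval (quotient g a) x ≡ eval (quotient h a) x) ys
      quotientsAgree []             []             = []
      quotientsAgree (a≢y ∷ a≢ys) (gy≡hy ∷ agree′) =
        quotient-agree g h (λ y≡a → a≢y (≡.sym y≡a)) ga≡ha gy≡hy ∷ quotientsAgree a≢ys agree′

module ConsistencyTester (F : FiniteField) (d : ℕ) where
  open FiniteField F using (Carrier; size; enum; _≟F_)
  open import Data.Nat
  open import Data.Nat.Properties
  open import Data.Fin using (Fin)
  open import Data.Fin.Properties using (any?)
  open import Data.Vec as Vec using (Vec; []; _∷_)
  open import Data.List using (_++_; [_]; allFin)
  open import Data.List.Properties using (map-cong; ++-assoc)
  open import Data.List.Relation.Unary.All as All using (All; []; _∷_)
  open import Data.List.Relation.Unary.All.Properties using (++⁻ˡ)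
  open import Data.List.Relation.Unary.AllPairs using (AllPairs; _∷_)
  open import Data.List.Membership.Propositional using (_∈_)
  open import Data.List.Membership.Propositional.Properties using (∈-++⁺ˡ; ∈-++⁺ʳ)
  open import Data.List.Relation.Unary.Any using (here)
  open import Data.Maybe using (Maybe; just; nothing; fromMaybe)
  open import Function.Bundles using (Inverse)
  open import Relation.Nullary.Decidable using (⌊_⌋; map′)
  open ≡ using (refl; sym; trans; subst)
  open ListCounting
  open NatArithmetic
  open Polynomial F
  open import Data.Nat.Tactic.RingSolver using (solve-∀)

  Poly : Set
  Poly = Vec Carrier (suc d)

  eval : Poly → Carrier → Carrier
  eval = evalPoly F

  Sample : Set
  Sample = Carrier × Maybe Carrier

  Fits : Poly → Sample → Set
  Fits cs (x , v) = ∀ y → v ≡ just y → y ≡ eval cs x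

  fits? : ∀ cs s → Dec (Fits cs s)
  fits? cs (x , nothing) = yes λ _ ()
  fits? cs (x , just y)  = map′ (λ { y≡ _ refl → y≡ }) (λ fits → fits y refl) (y ≟F eval cs x)

  Consistent : List Sample → Set
  Consistent ss = Σ Poly λ cs → All (Fits cs) ss

  any-Carrier? : {P : Pred Carrier 0ℓ} → Decidable P → Dec (Σ Carrier P)
  any-Carrier? {P} P? = map′ (λ (i , p) → elem F i , p)
    (λ (x , p) → Inverse.from enum x , subst P (sym (Inverse.strictlyInverseˡ enum x)) p)
    (any? (λ i → P? (elem F i)))

  any-Vec? : ∀ n {P : Pred (Vec Carrier n) 0ℓ} → Decidable P → Dec (Σ (Vec Carrier n) P)
  any-Vec? zero    P? = map′ ([] ,_) (λ { ([] , p) → p }) (P? [])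
  any-Vec? (suc n) P? = map′ (λ (x , v , p) → x ∷ v , p) (λ { (x ∷ v , p) → x , v , p })
    (any-Carrier? λ x → any-Vec? n λ v → P? (x ∷ v))

  consistent? : ∀ ss → Dec (Consistent ss)
  consistent? ss = any-Vec? (suc d) λ cs → All.all? (fits? cs) ss

  tester : ℕ → UniformTester F
  tester m = record { queries = m ; coins = 0 ; decide = λ samples _ → ⌊ consistent? (Vec.toList samples) ⌋ }

  -- With a single seed, countSeeds is the 0/1 indicator of acceptance.
  accepted : List Sample → ℕ
  accepted ss = countSeeds F 1 λ _ → ⌊ consistent? ss ⌋

  accepted-consistent : ∀ {ss} → Consistent ss → accepted ss ≡ 1
  accepted-consistent {ss} c with consistent? ss
  ... | yes _ = refl
  ... | no ¬c = ⊥-elim (¬c c)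

  accepted-inconsistent : ∀ {ss} → ¬ Consistent ss → accepted ss ≡ 0
  accepted-inconsistent {ss} ¬c with consistent? ss
  ... | yes c = ⊥-elim (¬c c)
  ... | no _  = refl

  accepted-≤1 : ∀ ss → accepted ss ≤ 1
  accepted-≤1 ss with consistent? ss
  ... | yes _ = ≤-refl
  ... | no _  = z≤n

  sumVecs-cong : ∀ m {g h : Vec (Fin size) m → ℕ} → (∀ v → g v ≡ h v) →
    sumVecs F m g ≡ sumVecs F m h
  sumVecs-cong zero    g≗h = g≗h []
  sumVecs-cong (suc m) g≗h = cong sum (map-cong (λ i → sumVecs-cong m (λ v → g≗h (i ∷ v))) (allFin size))

  sumVecs-const : ∀ m k → sumVecs F m (λ _ → k) ≡ size ^ m * k
  sumVecs-const zero    k = sym (+-identityʳ k)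
  sumVecs-const (suc m) k = begin
    sum (map (λ _ → sumVecs F m (λ _ → k)) (allFin size))
      ≡⟨ cong sum (map-cong (λ _ → sumVecs-const m k) (allFin size)) ⟩
    sum (map (λ _ → size ^ m * k) (allFin size))           ≡⟨ sum-map-const _ (allFin size) ⟩
    length (allFin size) * (size ^ m * k)                  ≡⟨ cong (_* (size ^ m * k)) (length-allFin size) ⟩
    size * (size ^ m * k)                                  ≡⟨ *-assoc size _ k ⟨
    size ^ suc m * k                                       ∎
    where open ≡.≡-Reasoning

  module _ (f : ErasedFun F) where

    sample : Fin size → Sample
    sample i = elem F i , f (elem F i)

    extensions : List Sample → ℕ → ℕ
    extensions ss m = sumVecs F m λ v → accepted (ss ++ Vec.toList (Vec.map sample v))

    extensions-inconsistent : ∀ {ss} → ¬ Consistent ss → ∀ m → extensions ss m ≡ 0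
    extensions-inconsistent {ss} ¬c m = begin
      extensions ss m
        ≡⟨ sumVecs-cong m (λ v → accepted-inconsistent (λ (cs , fits) → ¬c (cs , ++⁻ˡ ss fits))) ⟩
      sumVecs F m (λ _ → 0)     ≡⟨ sumVecs-const m 0 ⟩
      size ^ m * 0              ≡⟨ *-zeroʳ (size ^ m) ⟩
      0                         ∎
      where open ≡.≡-Reasoning

    extensions-suc : ∀ ss m →
      extensions ss (suc m) ≡ sum (map (λ i → extensions (ss ++ [ sample i ]) m) (allFin size))
    extensions-suc ss m = cong sum (map-cong (λ i → sumVecs-cong m (λ v →
      cong accepted (sym (++-assoc ss [ sample i ] (Vec.toList (Vec.map sample v)))))) (allFin size))

    complete : ∀ m → RestorableToPoly F d f → AcceptsWHP F (tester m) f
    complete m (h , restores , cs , h≗cs) = subst (λ n → 2 * (size ^ m * 1) ≤ 3 * n) (sym allAccepted)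
      (*-monoˡ-≤ (size ^ m * 1) {2} {3} (s≤s (s≤s z≤n)))
      where
        fitsEverywhere : ∀ {n} (v : Vec (Fin size) n) → All (Fits cs) (Vec.toList (Vec.map sample v))
        fitsEverywhere []      = []
        fitsEverywhere (i ∷ v) = (λ y fx≡y → trans (sym (restores _ y fx≡y)) (h≗cs _)) ∷ fitsEverywhere v
        allAccepted : acceptCount F (tester m) f ≡ size ^ m * 1
        allAccepted = trans (sumVecs-cong m (λ v → accepted-consistent (cs , fitsEverywhere v)))
                            (sumVecs-const m 1)

    fill : Poly → Carrier → Carrier
    fill cs x = fromMaybe (eval cs x) (f x)

    fill-restores : ∀ cs → Restoration F f (fill cs)
    fill-restores cs x y fx≡y rewrite fx≡y = refl

    Disagrees : Poly → Fin size → Set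
    Disagrees cs i = f (elem F i) ≢ nothing × fill cs (elem F i) ≢ eval cs (elem F i)

    disagrees? : ∀ cs → Decidable (Disagrees cs)
    disagrees? cs i = disagree F f (fill cs) (eval cs) (elem F i)

    disagreements : Poly → ℕ
    disagreements cs = countF F (disagree F f (fill cs) (eval cs))

    fill-fitted : ∀ c cs {ss x} → All (Fits cs) ss → (x , f x) ∈ ss → f x ≢ nothing →
      fill c x ≡ eval cs x
    fill-fitted c cs {x = x} fitsAll x∈ss nonErased with f x | All.lookup fitsAll x∈ss
    ... | nothing | _    = ⊥-elim (nonErased refl)
    ... | just y  | fits = fits y refl

    record Anchored (ss : List Sample) (xs : List Carrier) : Set where
      field
        distinct : AllPairs _≢_ xs
        sampled  : All (λ x → (x , f x) ∈ ss × f x ≢ nothing) xs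
    open Anchored

    anchored-[] : Anchored [] []
    anchored-[] = record { distinct = AllPairs.[] ; sampled = [] }

    anchored-++ : ∀ {ss xs} ys → Anchored ss xs → Anchored (ss ++ ys) xs
    anchored-++ ys A = record { distinct = distinct A ; sampled = All.map (map₁ ∈-++⁺ˡ) (sampled A) }

    anchored-fresh : ∀ cs {ss xs i} → All (Fits cs) ss → Disagrees cs i → Anchored ss xs →
      Anchored (ss ++ [ sample i ]) (elem F i ∷ xs)
    anchored-fresh cs {ss} {xs} {i} fitsAll (nonErased , misfit) A = record
      { distinct = All.map (λ (x∈ , ne) i≡x → misfit (subst (λ z → fill cs z ≡ eval cs z) (sym i≡x)
                                                         (fill-fitted cs cs fitsAll x∈ ne))) (sampled A)
                   ∷ distinct A
      ; sampled  = (∈-++⁺ʳ ss (here refl) , nonErased) ∷ sampled (anchored-++ [ sample i ] A)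
      }

    anchored-pins : ∀ cs {ss xs i} → All (Fits cs) ss → Disagrees cs i → Anchored ss xs → d < length xs →
      ¬ Consistent (ss ++ [ sample i ])
    anchored-pins cs {ss} {xs} {i} fitsAll (nonErased , misfit) A d<k (cs′ , fits′) =
      misfit (trans (fill-fitted cs cs′ fits′ (∈-++⁺ʳ ss (here refl)) nonErased)
                    (evalPoly-unique cs′ cs xs (distinct A) d<k agree (elem F i)))
      where
        agree : All (λ x → eval cs′ x ≡ eval cs x) xs
        agree = All.map (λ (x∈ , ne) → trans (sym (fill-fitted cs cs′ fits′ (∈-++⁺ˡ x∈) ne))
                                             (fill-fitted cs cs fitsAll x∈ ne))
                        (sampled A)

    private
      spend-budget : ∀ {r k} → d < r + k → ¬ d < k → Σ ℕ λ r′ → r ≡ suc r′ × d < r′ + suc k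
      spend-budget {zero}   d<k   d≮k = ⊥-elim (d≮k d<k)
      spend-budget {suc r′} {k} d<r+k _ = r′ , refl , subst (d <_) (sym (+-suc r′ k)) d<r+k

    module _ (a : ℕ) (a≤disagreements : ∀ cs → a ≤ disagreements cs) where

      sum-halved-on-disagreements : ∀ cs (G : Fin size → ℕ) U →
        (∀ {i} → Disagrees cs i → G i + U ≤ 2 * U) → (∀ {i} → ¬ Disagrees cs i → G i ≤ 2 * U) →
        sum (map G (allFin size)) ≤ (2 * size ∸ a) * U
      sum-halved-on-disagreements cs G U disagreeing agreeing = begin
        ΣG                    ≤⟨ m+n≤o⇒m≤o∸n ΣG (≤-trans (+-monoʳ-≤ ΣG (*-monoˡ-≤ U (a≤disagreements cs)))
                                                         split) ⟩
        2 * size * U ∸ a * U  ≡⟨ *-distribʳ-∸ U (2 * size) a ⟨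
        (2 * size ∸ a) * U    ∎
        where
          open ≤-Reasoning
          ΣG = sum (map G (allFin size))
          swap : ∀ q u → q * (2 * u) ≡ 2 * q * u
          swap = solve-∀
          split : ΣG + disagreements cs * U ≤ 2 * size * U
          split = subst (ΣG + disagreements cs * U ≤_)
                        (trans (cong (_* (2 * U)) (length-allFin size)) (swap size U))
                        (sum-map-filter-≤ (disagrees? cs) G disagreeing agreeing (allFin size))

      extensions-bound : ∀ m r {ss xs} → Anchored ss xs → d < r + length xs →
        2 ^ m * extensions ss m ≤ 2 ^ suc r * (2 * size ∸ a) ^ m
      extensions-bound zero r {ss} A _ = begin
        1 * accepted (ss ++ [])  ≡⟨ *-identityˡ _ ⟩
        accepted (ss ++ [])      ≤⟨ accepted-≤1 _ ⟩
        1                        ≤⟨ m^n>0 2 (suc r) ⟩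
        2 ^ suc r                ≡⟨ *-identityʳ _ ⟨
        2 ^ suc r * 1            ∎
        where open ≤-Reasoning
      extensions-bound (suc m) r {ss} {xs} A budget with consistent? ss
      ... | no ¬c = begin
        2 ^ suc m * extensions ss (suc m)  ≡⟨ cong (2 ^ suc m *_) (extensions-inconsistent ¬c (suc m)) ⟩
        2 ^ suc m * 0                      ≡⟨ *-zeroʳ (2 ^ suc m) ⟩
        0                                  ≤⟨ z≤n ⟩
        2 ^ suc r * (2 * size ∸ a) ^ suc m ∎
        where open ≤-Reasoning
      ... | yes (cs , fitsAll) = begin
        2 ^ suc m * extensions ss (suc m)       ≡⟨ cong (2 ^ suc m *_) (extensions-suc ss m) ⟩
        2 * 2 ^ m * sum (map E (allFin size))   ≡⟨ *-assoc 2 (2 ^ m) _ ⟩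
        2 * (2 ^ m * sum (map E (allFin size))) ≡⟨ cong (2 *_) (sum-map-*ˡ (2 ^ m) E (allFin size)) ⟨
        2 * sum (map G (allFin size))
          ≤⟨ *-monoʳ-≤ 2 (sum-halved-on-disagreements cs G U disagreeing agreeing) ⟩
        2 * (X * (2 ^ r * X ^ m))               ≡⟨ regroup (2 ^ r) X (X ^ m) ⟩
        2 ^ suc r * X ^ suc m                   ∎
        where
          open ≤-Reasoning
          X = 2 * size ∸ a
          U = 2 ^ r * X ^ m
          E G : Fin size → ℕ
          E i = extensions (ss ++ [ sample i ]) m
          G i = 2 ^ m * E i

          regroup : ∀ p x y → 2 * (x * (p * y)) ≡ (2 * p) * (x * y)
          regroup = solve-∀

          agreeing : ∀ {i} → ¬ Disagrees cs i → G i ≤ 2 * U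
          agreeing {i} _ = subst (G i ≤_) (*-assoc 2 (2 ^ r) (X ^ m))
                                 (extensions-bound m r (anchored-++ [ sample i ] A) budget)

          disagreeing : ∀ {i} → Disagrees cs i → G i + U ≤ 2 * U
          disagreeing {i} dis with d <? length xs
          ... | yes d<k = begin
            G i + U        ≡⟨ cong (λ e → 2 ^ m * e + U)
                                   (extensions-inconsistent (anchored-pins cs fitsAll dis A d<k) m) ⟩
            2 ^ m * 0 + U  ≡⟨ cong (_+ U) (*-zeroʳ (2 ^ m)) ⟩
            U              ≤⟨ m≤n*m U 2 ⟩
            2 * U          ∎
          ... | no d≮k with spend-budget budget d≮k
          ...   | r′ , r≡1+r′ , budget′ = begin
            G i + U
              ≤⟨ +-monoˡ-≤ U (extensions-bound m r′ (anchored-fresh cs fitsAll dis A) budget′) ⟩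
            2 ^ suc r′ * X ^ m + U  ≡⟨ cong (λ t → 2 ^ t * X ^ m + U) r≡1+r′ ⟨
            U + U                   ≡⟨ cong (U +_) (+-identityʳ U) ⟨
            2 * U                   ∎

    sound-from-threshold : ∀ L a → (∀ cs → a ≤ disagreements cs) → a ≤ 2 * size → 2 * size ≤ suc L * a →
      RejectsWHP F (tester (suc L * (d + 4))) f
    sound-from-threshold L a a≤disagreements a≤2size 2size≤La =
      subst (3 * extensions [] m ≤_) (sym (*-identityʳ (size ^ m))) (*-cancelˡ-≤ (2 ^ m) {{m^n≢0 2 m}} (begin
        2 ^ m * (3 * B)                ≡⟨ *-comm-middle (2 ^ m) 3 B ⟩
        3 * (2 ^ m * B)                ≤⟨ *-monoʳ-≤ 3 (extensions-bound a a≤disagreements m (suc d) anchored-[]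
                                                                         (s≤s (m≤m+n d 0))) ⟩
        3 * (2 ^ suc (suc d) * X ^ m)  ≤⟨ three-quarters d (X ^ m) ⟩
        2 ^ (d + 4) * X ^ m            ≤⟨ doubling-^ L (d + 4) X a (≤-trans (m∸n≤m (2 * size) a) 2size≤La) ⟩
        (X + a) ^ m                    ≡⟨ cong (_^ m) (m∸n+n≡m a≤2size) ⟩
        (2 * size) ^ m                 ≡⟨ ^-distribʳ-* 2 size m ⟩
        2 ^ m * size ^ m               ∎))
      where
        open ≤-Reasoning
        m = suc L * (d + 4)
        B = extensions [] m
        X = 2 * size ∸ a
        *-comm-middle : ∀ p t b → p * (t * b) ≡ t * (p * b)
        *-comm-middle = solve-∀
        three-quarters : ∀ k y → 3 * (2 ^ suc (suc k) * y) ≤ 2 ^ (k + 4) * y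
        three-quarters k y = begin
          3 * (2 ^ suc (suc k) * y)   ≤⟨ *-monoˡ-≤ (2 ^ suc (suc k) * y) (n≤1+n 3) ⟩
          4 * (2 ^ suc (suc k) * y)   ≡⟨ sixteen (2 ^ k) y ⟩
          2 ^ k * 16 * y              ≡⟨ cong (_* y) (^-distribˡ-+-* 2 k 4) ⟨
          2 ^ (k + 4) * y             ∎
          where
            sixteen : ∀ p y → 4 * (2 * (2 * p) * y) ≡ p * 16 * y
            sixteen = solve-∀

    sound : ∀ L → (∀ cs → 2 * size ≤ suc L * disagreements cs) → RejectsWHP F (tester (suc L * (d + 4))) f
    sound L far with least (λ n → 2 * size ≤? suc L * n) (m≤n*m (2 * size) (suc L))
    ... | a , 2size≤La , minimal =
      sound-from-threshold L a (λ cs → minimal (far cs)) (minimal (m≤n*m (2 * size) (suc L))) 2size≤La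

open import Data.Rational using (ℚ; 0ℚ; 1ℚ; _≤_; _<_; _+_; _-_; _*_)
open import Data.Rational as ℚ using (mkℚ; -_; toℚᵘ; nonNegative; positive)
open import Data.Rational.Properties
import Data.Rational.Unnormalised as ℚᵘ
import Data.Rational.Unnormalised.Properties as ℚᵘ
open import Data.Rational.Solver using (module +-*-Solver)
import Data.Integer as ℤ
import Data.Integer.Properties as ℤ
import Data.Nat as ℕ
import Data.Nat.Properties as ℕ
import Data.Nat.Coprimality as Coprime
open +-*-Solver using (solve; _:+_; _:*_; _:-_; _:=_; con)
open ≡ using (refl; sym; trans; subst; subst₂)
open import Relation.Nullary.Decidable using (decidable-stable)

ℕ→ℚ≡mkℚ : ∀ n → ℕ→ℚ n ≡ mkℚ (ℤ.+ n) 0 (Coprime.sym (Coprime.1-coprimeTo n))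
ℕ→ℚ≡mkℚ n = normalize-coprime (Coprime.sym (Coprime.1-coprimeTo n))

ℕ→ℚ-homo-+ : ∀ m n → ℕ→ℚ (m ℕ.+ n) ≡ ℕ→ℚ m + ℕ→ℚ n
ℕ→ℚ-homo-+ m n =
  trans (/-cong {ℤ.+ (m ℕ.+ n)} {1} numerators refl) (sym (cong₂ _+_ (ℕ→ℚ≡mkℚ m) (ℕ→ℚ≡mkℚ n)))
  where
    numerators : ℤ.+ (m ℕ.+ n) ≡ ℤ.+ m ℤ.* ℤ.+ 1 ℤ.+ ℤ.+ n ℤ.* ℤ.+ 1
    numerators = trans (ℤ.pos-+ m n) (sym (cong₂ ℤ._+_ (ℤ.*-identityʳ (ℤ.+ m)) (ℤ.*-identityʳ (ℤ.+ n))))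

ℕ→ℚ-homo-* : ∀ m n → ℕ→ℚ (m ℕ.* n) ≡ ℕ→ℚ m * ℕ→ℚ n
ℕ→ℚ-homo-* m n =
  trans (/-cong {ℤ.+ (m ℕ.* n)} {1} (ℤ.pos-* m n) refl) (sym (cong₂ _*_ (ℕ→ℚ≡mkℚ m) (ℕ→ℚ≡mkℚ n)))

ℕ→ℚ-mono-≤ : ∀ {m n} → m ℕ.≤ n → ℕ→ℚ m ≤ ℕ→ℚ n
ℕ→ℚ-mono-≤ {m} {n} m≤n = subst₂ _≤_ (sym (ℕ→ℚ≡mkℚ m)) (sym (ℕ→ℚ≡mkℚ n))
  (ℚ.*≤* (subst₂ ℤ._≤_ (sym (ℤ.*-identityʳ (ℤ.+ m))) (sym (ℤ.*-identityʳ (ℤ.+ n))) (ℤ.+≤+ m≤n)))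

ℕ→ℚ-cancel-≤ : ∀ {m n} → ℕ→ℚ m ≤ ℕ→ℚ n → m ℕ.≤ n
ℕ→ℚ-cancel-≤ {m} {n} le with subst₂ _≤_ (ℕ→ℚ≡mkℚ m) (ℕ→ℚ≡mkℚ n) le
... | ℚ.*≤* m≤n = ℤ.drop‿+≤+ (subst₂ ℤ._≤_ (ℤ.*-identityʳ (ℤ.+ m)) (ℤ.*-identityʳ (ℤ.+ n)) m≤n)

ℕ→ℚ-nonNeg : ∀ n → 0ℚ ≤ ℕ→ℚ n
ℕ→ℚ-nonNeg n = ℕ→ℚ-mono-≤ {0} {n} ℕ.z≤n

*-monoˡ-≤-ℕ→ℚ : ∀ n {p q} → p ≤ q → ℕ→ℚ n * p ≤ ℕ→ℚ n * q
*-monoˡ-≤-ℕ→ℚ n = *-monoˡ-≤-nonNeg (ℕ→ℚ n) {{nonNegative (ℕ→ℚ-nonNeg n)}}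

*-monoʳ-≤-ℕ→ℚ : ∀ n {p q} → p ≤ q → p * ℕ→ℚ n ≤ q * ℕ→ℚ n
*-monoʳ-≤-ℕ→ℚ n = *-monoʳ-≤-nonNeg (ℕ→ℚ n) {{nonNegative (ℕ→ℚ-nonNeg n)}}

ℕ→ℚ-+-nonNeg : ∀ m n → 0ℚ ≤ ℕ→ℚ m + ℕ→ℚ n
ℕ→ℚ-+-nonNeg m n = subst (0ℚ ≤_) (ℕ→ℚ-homo-+ m n) (ℕ→ℚ-nonNeg (m ℕ.+ n))

-- For p = (n + 1)/(d + 1), take K = 2 (d + 1); then K p = 2 (n + 1) ≥ 2.
archimedean : ∀ p → 0ℚ < p → Σ ℕ λ K → ℕ→ℚ 2 ≤ ℕ→ℚ K * p
archimedean (mkℚ (ℤ.+ 0)    _ _) (ℚ.*<* (ℤ.+<+ ()))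
archimedean (mkℚ ℤ.-[1+ _ ] _ _) (ℚ.*<* ())
archimedean p@(mkℚ (ℤ.+ (suc n)) d-1 _) _ = K , toℚᵘ-cancel-≤
  (ℚᵘ.≤-respʳ-≃ (ℚᵘ.≃-sym (toℚᵘ-homo-* (ℕ→ℚ K) p))
    (subst (λ k → toℚᵘ (ℕ→ℚ 2) ℚᵘ.≤ toℚᵘ k ℚᵘ.* toℚᵘ p) (sym (ℕ→ℚ≡mkℚ K)) unnormalised))
  where
    K = 2 ℕ.* suc d-1
    unnormalised : toℚᵘ (ℕ→ℚ 2) ℚᵘ.≤ ℚᵘ.mkℚᵘ (ℤ.+ K) 0 ℚᵘ.* ℚᵘ.mkℚᵘ (ℤ.+ suc n) d-1
    unnormalised = ℚᵘ.*≤* (subst₂ ℤ._≤_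
      (trans (ℤ.pos-* 2 (suc d-1)) (cong (λ t → ℤ.+ 2 ℤ.* ℤ.+ t) (sym (ℕ.*-identityˡ (suc d-1)))))
      (trans (ℤ.pos-* K (suc n)) (sym (ℤ.*-identityʳ _)))
      (ℤ.+≤+ (ℕ.m≤m*n K (suc n))))

scale-into-[2,3] : ∀ p → 0ℚ < p → p ≤ 1ℚ →
  Σ ℕ λ L → ℕ→ℚ 2 ≤ ℕ→ℚ (suc L) * p × ℕ→ℚ (suc L) * p ≤ ℕ→ℚ 3
scale-into-[2,3] p 0<p p≤1 with archimedean p 0<p
... | K , 2≤Kp with NatArithmetic.least (λ n → ℕ→ℚ 2 ≤? ℕ→ℚ n * p) {K} 2≤Kp
...   | suc L , 2≤Lp , minimal = L , 2≤Lp , (begin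
  ℕ→ℚ (suc L) * p      ≡⟨ cong (_* p) (ℕ→ℚ-homo-+ 1 L) ⟩
  (1ℚ + ℕ→ℚ L) * p     ≡⟨ solve 2 (λ x y → (con 1ℚ :+ x) :* y := y :+ x :* y) refl (ℕ→ℚ L) p ⟩
  p + ℕ→ℚ L * p        ≤⟨ +-mono-≤ p≤1 (<⇒≤ (≰⇒> λ 2≤L′p → ℕ.<-irrefl refl (minimal {L} 2≤L′p))) ⟩
  1ℚ + ℕ→ℚ 2           ≡⟨ ℕ→ℚ-homo-+ 1 2 ⟨
  ℕ→ℚ 3                ∎)
  where open ≤-Reasoning
...   | zero  , 2≤0p , _ with ℕ→ℚ-cancel-≤ {2} {0} (subst (ℕ→ℚ 2 ≤_) (*-zeroˡ p) 2≤0p)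
...     | ()

α<1 : ∀ {D α ε} → 0ℚ ≤ D → 0ℚ < ε → α * (D + ε) < ε → α < 1ℚ
α<1 {D} {α} {ε} 0≤D 0<ε α[D+ε]<ε with α <? 1ℚ
... | yes α<1 = α<1
... | no α≮1 = ⊥-elim (<-irrefl refl (≤-<-trans ε≤α[D+ε] α[D+ε]<ε))
  where
    open ≤-Reasoning
    ε≤α[D+ε] : ε ≤ α * (D + ε)
    ε≤α[D+ε] = begin
      ε                ≡⟨ +-identityˡ ε ⟨
      0ℚ + ε           ≤⟨ +-monoˡ-≤ ε 0≤D ⟩
      D + ε            ≡⟨ *-identityˡ (D + ε) ⟨
      1ℚ * (D + ε)     ≤⟨ *-monoʳ-≤-nonNeg (D + ε) {{nonNegative (+-mono-≤ 0≤D (<⇒≤ 0<ε))}} (≮⇒≥ α≮1) ⟩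
      α * (D + ε)      ∎

0<ε[1-α]≤1 : ∀ {α ε} → 0ℚ ≤ α → α < 1ℚ → 0ℚ < ε → ε ≤ 1ℚ →
  0ℚ < ε * (1ℚ - α) × ε * (1ℚ - α) ≤ 1ℚ
0<ε[1-α]≤1 {α} {ε} 0≤α α<1 0<ε ε≤1 =
  positive⁻¹ _ {{pos*pos⇒pos ε {{positive 0<ε}} _ {{positive 0<1-α}}}} , (begin
  ε * (1ℚ - α)     ≤⟨ *-monoʳ-≤-nonNeg (1ℚ - α) {{nonNegative (<⇒≤ 0<1-α)}} ε≤1 ⟩
  1ℚ * (1ℚ - α)    ≡⟨ *-identityˡ (1ℚ - α) ⟩
  1ℚ - α           ≤⟨ +-monoʳ-≤ 1ℚ (neg-antimono-≤ 0≤α) ⟩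
  1ℚ - 0ℚ          ∎)
  where
    open ≤-Reasoning
    0<1-α : 0ℚ < 1ℚ - α
    0<1-α = subst (_< 1ℚ - α) (+-inverseʳ α) (+-monoˡ-< (- α) α<1)

nonErased-lower-bound : ∀ {n e q α} → n + e ≡ q → e ≤ α * q → (1ℚ - α) * q ≤ n
nonErased-lower-bound {n} {e} {q} {α} n+e≡q e≤αq = begin
  (1ℚ - α) * q     ≡⟨ solve 2 (λ a q → (con 1ℚ :- a) :* q := q :- a :* q) refl α q ⟩
  q - α * q        ≤⟨ +-monoʳ-≤ q (neg-antimono-≤ e≤αq) ⟩
  q - e            ≡⟨ cong (_- e) n+e≡q ⟨
  (n + e) - e      ≡⟨ solve 2 (λ n e → (n :+ e) :- e := n) refl n e ⟩
  n                ∎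
  where open ≤-Reasoning

nonErased+erased≡size : ∀ F f → numNonErased F f ℕ.+ countF F (isErased F f) ≡ FiniteField.size F
nonErased+erased≡size F f = trans
  (length-filter-complement (λ i → isNonErased F f (elem F i)) (λ i → isErased F f (elem F i))
    (λ nonErased erased → nonErased erased) (λ {i} → decidable-stable (isErased F f (elem F i))) (allFin size))
  (length-allFin size)
  where
    open FiniteField F using (size)
    open ListCounting using (length-filter-complement)

module _ (F : FiniteField) (d : ℕ) where
  open FiniteField F using (size)
  open ConsistencyTester F d

  many-disagreements : ∀ α ε L (f : ErasedFun F) → IsErased F α f → FarFromPoly F d ε f → 0ℚ < ε →
    ℕ→ℚ 2 ≤ ℕ→ℚ (suc L) * (ε * (1ℚ - α)) → ∀ cs → 2 ℕ.* size ℕ.≤ suc L ℕ.* disagreements f cs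
  many-disagreements α ε L f erased far 0<ε 2≤Lp cs = ℕ→ℚ-cancel-≤ (begin
    ℕ→ℚ (2 ℕ.* size)                        ≡⟨ ℕ→ℚ-homo-* 2 size ⟩
    ℕ→ℚ 2 * q                               ≤⟨ *-monoʳ-≤-ℕ→ℚ size 2≤Lp ⟩
    (ℕ→ℚ (suc L) * (ε * (1ℚ - α))) * q      ≡⟨ reassociate (ℕ→ℚ (suc L)) ε α q ⟩
    ℕ→ℚ (suc L) * (ε * ((1ℚ - α) * q))      ≤⟨ *-monoˡ-≤-ℕ→ℚ (suc L) ε[1-α]q≤disagreements ⟩
    ℕ→ℚ (suc L) * ℕ→ℚ (disagreements f cs)  ≡⟨ ℕ→ℚ-homo-* (suc L) (disagreements f cs) ⟨
    ℕ→ℚ (suc L ℕ.* disagreements f cs)      ∎)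
    where
      open ≤-Reasoning
      q = ℕ→ℚ size
      reassociate : ∀ L e a q → (L * (e * (1ℚ - a))) * q ≡ L * (e * ((1ℚ - a) * q))
      reassociate = solve 4 (λ L e a q → (L :* (e :* (con 1ℚ :- a))) :* q
                                      := L :* (e :* ((con 1ℚ :- a) :* q))) refl
      ε[1-α]q≤disagreements : ε * ((1ℚ - α) * q) ≤ ℕ→ℚ (disagreements f cs)
      ε[1-α]q≤disagreements = begin
        ε * ((1ℚ - α) * q)
          ≤⟨ *-monoˡ-≤-nonNeg ε {{nonNegative (<⇒≤ 0<ε)}} (nonErased-lower-bound {α = α} n+e≡q erased) ⟩
        ε * ℕ→ℚ (numNonErased F f)
          ≤⟨ far (fill f cs) (fill-restores f cs) (eval cs) (cs , λ _ → refl) ⟩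
        ℕ→ℚ (disagreements f cs)
          ∎
        where
          n+e≡q = trans (sym (ℕ→ℚ-homo-+ (numNonErased F f) (countF F (isErased F f))))
                        (cong ℕ→ℚ (nonErased+erased≡size F f))

  consistency-tester-resilient : ∀ α ε L → 0ℚ < ε → ℕ→ℚ 2 ≤ ℕ→ℚ (suc L) * (ε * (1ℚ - α)) →
    IsErasureResilientTester F d α ε (tester (suc L ℕ.* (d ℕ.+ 4)))
  consistency-tester-resilient α ε L 0<ε 2≤Lp f erased =
    complete f (suc L ℕ.* (d ℕ.+ 4)) , λ far → sound f L (many-disagreements α ε L f erased far 0<ε 2≤Lp)

query-bound : ∀ L d α ε → 0ℚ ≤ α → ℕ→ℚ (suc L) * (ε * (1ℚ - α)) ≤ ℕ→ℚ 3 →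
  ℕ→ℚ (suc L ℕ.* (d ℕ.+ 4)) * (ε * (1ℚ - α) - α * (ℕ→ℚ d + ℕ→ℚ 2))
    ≤ ℕ→ℚ 6 * (ℕ→ℚ d + ℕ→ℚ 2)
query-bound L d α ε 0≤α Lp≤3 = begin
  ℕ→ℚ m * (p - α * D)                    ≤⟨ *-monoˡ-≤-ℕ→ℚ m p-αD≤p ⟩
  ℕ→ℚ m * p                              ≡⟨ cong (_* p) (ℕ→ℚ-homo-* (suc L) (d ℕ.+ 4)) ⟩
  (ℕ→ℚ (suc L) * ℕ→ℚ (d ℕ.+ 4)) * p      ≡⟨ swap (ℕ→ℚ (suc L)) (ℕ→ℚ (d ℕ.+ 4)) p ⟩
  (ℕ→ℚ (suc L) * p) * ℕ→ℚ (d ℕ.+ 4)      ≤⟨ *-monoʳ-≤-ℕ→ℚ (d ℕ.+ 4) Lp≤3 ⟩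
  ℕ→ℚ 3 * ℕ→ℚ (d ℕ.+ 4)                  ≡⟨ ℕ→ℚ-homo-* 3 (d ℕ.+ 4) ⟨
  ℕ→ℚ (3 ℕ.* (d ℕ.+ 4))                  ≤⟨ ℕ→ℚ-mono-≤ (3[d+4]≤6[d+2] d) ⟩
  ℕ→ℚ (6 ℕ.* (d ℕ.+ 2))                  ≡⟨ ℕ→ℚ-homo-* 6 (d ℕ.+ 2) ⟩
  ℕ→ℚ 6 * ℕ→ℚ (d ℕ.+ 2)                  ≡⟨ cong (ℕ→ℚ 6 *_) (ℕ→ℚ-homo-+ d 2) ⟩
  ℕ→ℚ 6 * D                              ∎
  where
    open ≤-Reasoning
    open import Data.Nat.Tactic.RingSolver using (solve-∀)
    m = suc L ℕ.* (d ℕ.+ 4)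
    p = ε * (1ℚ - α)
    D = ℕ→ℚ d + ℕ→ℚ 2
    0≤αD : 0ℚ ≤ α * D
    0≤αD = nonNegative⁻¹ (α * D)
      {{nonNeg*nonNeg⇒nonNeg α {{nonNegative 0≤α}} D {{nonNegative (ℕ→ℚ-+-nonNeg d 2)}}}}
    swap : ∀ x y z → (x * y) * z ≡ (x * z) * y
    swap = solve 3 (λ x y z → (x :* y) :* z := (x :* z) :* y) refl
    p-αD≤p : p - α * D ≤ p
    p-αD≤p = subst (p - α * D ≤_) (+-identityʳ p) (+-monoʳ-≤ p (neg-antimono-≤ 0≤αD))
    3[d+4]≤6[d+2] : ∀ d → 3 ℕ.* (d ℕ.+ 4) ℕ.≤ 6 ℕ.* (d ℕ.+ 2)
    3[d+4]≤6[d+2] d =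
      subst (3 ℕ.* (d ℕ.+ 4) ℕ.≤_) (expand d) (ℕ.m≤m+n (3 ℕ.* (d ℕ.+ 4)) (3 ℕ.* d))
      where
        expand : ∀ d → 3 ℕ.* (d ℕ.+ 4) ℕ.+ 3 ℕ.* d ≡ 6 ℕ.* (d ℕ.+ 2)
        expand = solve-∀

corollary2p3 : Σ ℕ λ C → ∀ (F : FiniteField) (d : ℕ) (α ε : ℚ) →
    0ℚ ≤ α → 0ℚ < ε → ε ≤ 1ℚ →
    α * (ℕ→ℚ d + ℕ→ℚ 2 + ε) < ε →
    Σ (UniformTester F) λ T →
      IsErasureResilientTester F d α ε T ×
      (ℕ→ℚ (UniformTester.queries T) * (ε * (1ℚ - α) - α * (ℕ→ℚ d + ℕ→ℚ 2))
        ≤ ℕ→ℚ C * (ℕ→ℚ d + ℕ→ℚ 2))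
corollary2p3 = 6 , λ F d α ε 0≤α 0<ε ε≤1 α[D+ε]<ε →
  let 0<p , p≤1       = 0<ε[1-α]≤1 0≤α (α<1 (ℕ→ℚ-+-nonNeg d 2) 0<ε α[D+ε]<ε) 0<ε ε≤1
      L , 2≤Lp , Lp≤3  = scale-into-[2,3] (ε * (1ℚ - α)) 0<p p≤1
  in ConsistencyTester.tester F d (suc L ℕ.* (d ℕ.+ 4)) ,
     consistency-tester-resilient F d α ε L 0<ε 2≤Lp ,
     query-bound L d α ε 0≤α Lp≤3
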